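{- Let $\mathbb{A}$ be an $\mathcal{L}$-algebra with $\mathbb{A}\models \Diamond\Box p\leq\Box\Diamond p$. Then the labelled rule (C), with premise $\Gamma, \mathbf{k}\leq \Diamond^{\bullet}\mathbf{j} \vdash \Diamond \mathbf{k}\leq \mathbf{m}, \Delta$ and conclusion $\Gamma, \mathbf{h}\leq \Diamond\mathbf{j} \vdash \Diamond^{\bullet}\mathbf{h}\leq \mathbf{m}, \Delta$ (where $\mathbf{k}$ does not occur in $\Gamma,\Delta$), is sound on the canonical extension $\mathbb{A}^\delta$.
   Context: An $\mathcal{L}$-algebra is a bounded lattice with a finitely join-preserving $\Diamond$ and a finitely meet-preserving $\Box$. The canonical extension $\mathbb{A}^\delta$ is a complete lattice containing $\mathbb{A}$ as a dense and compact sublattice, with $\Diamond$ interpreted by its completely join-preserving $\sigma$-extension and $\Box$ by its completely meet-preserving $\pi$-extension; $\Diamond^{\bullet}$ denotes the left adjoint of $\Box$ ($\Diamond^{\bullet}u\leq v$ iff $u\leq\Box v$; written as a black diamond in the paper) and $\blacksquare$ the right adjoint of $\Diamond$. Nominals $\mathbf{j},\mathbf{k},\mathbf{h}$ range over a completely join-generating subset and conominals $\mathbf{m}$ over a completely meet-generating subset of $\mathbb{A}^\delta$. A labelled sequent $\Gamma\vdash\Delta$ is interpreted as: every assignment of propositional variables, nominals and conominals satisfying all inequalities in $\Gamma$ satisfies some inequality in $\Delta$. Axiom (C) is canonical, so it also holds in $\mathbb{A}^\delta$, where it is equivalent to $\forall\mathbf{j}\forall\mathbf{m}(\Diamond\Diamond^{\bullet}\mathbf{j}\leq\mathbf{m}\Rightarrow\Diamond^{\bullet}\Diamond\mathbf{j}\leq\mathbf{m})$.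 -}

module Defs where

open import Level using (Level; suc; _⊔_)
open import Data.Nat using (ℕ)
open import Data.Product using (Σ; _×_; _,_; proj₁; ∃)
open import Data.List using (List; []; _∷_; foldr)
open import Data.List.Relation.Unary.All using (All)
open import Data.List.Relation.Unary.Any using (Any)
open import Relation.Binary.Core using (Rel)
open import Relation.Binary.Structures using (IsPartialOrder)
open import Relation.Binary.PropositionalEquality using (_≡_)
open import Relation.Binary.Lattice.Bundles using (BoundedLattice)
open import Relation.Nullary using (¬_)
open import Relation.Unary using (Pred)
open import Data.Unit using () renaming (⊤ to ⊤₀)
open import Function.Bundles using (_⇔_)
open import Data.Sum using () renaming (_⊎_ to _⊎'_)
open import Data.Empty.Polymorphic using () renaming (⊥ to Empty')

record LAlgebra (ℓ : Level) : Set (suc ℓ) where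
  field
    lattice : BoundedLattice ℓ ℓ ℓ
  open BoundedLattice lattice public hiding (lattice)
  field
    ◇ : Carrier → Carrier
    □ : Carrier → Carrier
    ◇-cong : ∀ {a b} → a ≈ b → ◇ a ≈ ◇ b
    □-cong : ∀ {a b} → a ≈ b → □ a ≈ □ b
    ◇-⊥ : ◇ ⊥ ≈ ⊥
    ◇-∨ : ∀ a b → ◇ (a ∨ b) ≈ (◇ a ∨ ◇ b)
    □-⊤ : □ ⊤ ≈ ⊤
    □-∧ : ∀ a b → □ (a ∧ b) ≈ (□ a ∧ □ b)

ModelsC : ∀ {ℓ} → LAlgebra ℓ → Set ℓ
ModelsC 𝔸 = ∀ a → ◇ (□ a) ≤ □ (◇ a)
  where open LAlgebra 𝔸

record CompleteLattice (ℓ : Level) : Set (suc ℓ) where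
  infix 4 _≈_ _≤_
  field
    Carrier : Set ℓ
    _≈_ : Rel Carrier ℓ
    _≤_ : Rel Carrier ℓ
    isPartialOrder : IsPartialOrder _≈_ _≤_
    ⋁ : {I : Set ℓ} → (I → Carrier) → Carrier
    ⋀ : {I : Set ℓ} → (I → Carrier) → Carrier
    ⋁-upper : ∀ {I} (f : I → Carrier) i → f i ≤ ⋁ f
    ⋁-least : ∀ {I} (f : I → Carrier) x → (∀ i → f i ≤ x) → ⋁ f ≤ x
    ⋀-lower : ∀ {I} (f : I → Carrier) i → ⋀ f ≤ f i
    ⋀-greatest : ∀ {I} (f : I → Carrier) x → (∀ i → x ≤ f i) → x ≤ ⋀ f

module _ {ℓ : Level} (𝔸 : LAlgebra ℓ) (ℂ : CompleteLattice ℓ)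
         (e : LAlgebra.Carrier 𝔸 → CompleteLattice.Carrier ℂ) where
  private
    module A = LAlgebra 𝔸
    module C = CompleteLattice ℂ

  img : (S : Pred A.Carrier ℓ) → Σ A.Carrier S → C.Carrier
  img S (a , _) = e a

  Closed : C.Carrier → Set (suc ℓ)
  Closed k = Σ (Pred A.Carrier ℓ) λ S → k C.≈ C.⋀ (img S)

  Open : C.Carrier → Set (suc ℓ)
  Open o = Σ (Pred A.Carrier ℓ) λ S → o C.≈ C.⋁ (img S)

  -- σ-extension of ◇ (as characterised in the literature):
  --   ◇σ k = ⋀ { e(◇a) | k ≤ e a }           for closed k
  --   ◇σ u = ⋁ { ◇σ k | k closed, k ≤ u }    for all u
  IsSigmaExt : (C.Carrier → C.Carrier) → Set (suc ℓ)
  IsSigmaExt f =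
    (∀ k → Closed k →
       f k C.≈ C.⋀ {Σ A.Carrier (λ a → k C.≤ e a)} (λ { (a , _) → e (A.◇ a) }))
    × (∀ u → (∀ k → Closed k → k C.≤ u → f k C.≤ f u)
           × (∀ v → (∀ k → Closed k → k C.≤ u → f k C.≤ v) → f u C.≤ v))

  -- π-extension of □:
  --   □π o = ⋁ { e(□a) | e a ≤ o }            for open o
  --   □π u = ⋀ { □π o | o open, u ≤ o }       for all u
  IsPiExt : (C.Carrier → C.Carrier) → Set (suc ℓ)
  IsPiExt g =
    (∀ o → Open o →
       g o C.≈ C.⋁ {Σ A.Carrier (λ a → e a C.≤ o)} (λ { (a , _) → e (A.□ a) }))
    × (∀ u → (∀ o → Open o → u C.≤ o → g u C.≤ g o)
           × (∀ v → (∀ o → Open o → u C.≤ o → v C.≤ g o) → v C.≤ g u))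

  record IsLatticeEmbedding : Set ℓ where
    field
      order-embedding : ∀ a b → (a A.≤ b) ⇔ (e a C.≤ e b)
      e-∧ : ∀ a b → e (a A.∧ b) C.≈ C.⋀ {Σ A.Carrier (λ x → (x ≡ a) ⊎' (x ≡ b))} (λ p → e (proj₁ p))
      e-∨ : ∀ a b → e (a A.∨ b) C.≈ C.⋁ {Σ A.Carrier (λ x → (x ≡ a) ⊎' (x ≡ b))} (λ p → e (proj₁ p))
      e-⊤ : e A.⊤ C.≈ C.⋀ {Σ A.Carrier (λ _ → Empty' {ℓ})} (λ p → e (proj₁ p))
      e-⊥ : e A.⊥ C.≈ C.⋁ {Σ A.Carrier (λ _ → Empty' {ℓ})} (λ p → e (proj₁ p))

record CanonicalExtension {ℓ : Level} (𝔸 : LAlgebra ℓ) : Set (suc ℓ) where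
  private module A = LAlgebra 𝔸
  field
    ℂ : CompleteLattice ℓ
  open CompleteLattice ℂ public
  field
    e : A.Carrier → Carrier
    embedding : IsLatticeEmbedding 𝔸 ℂ e
    -- density: every element is a join of closed elements and a
    -- meet of open elements
    dense-closed : ∀ u v → (∀ k → Closed 𝔸 ℂ e k → k ≤ u → k ≤ v) → u ≤ v
    dense-open : ∀ u v → (∀ o → Open 𝔸 ℂ e o → u ≤ o → v ≤ o) → v ≤ u
    compact : ∀ (S T : Pred A.Carrier ℓ) → ⋀ (img 𝔸 ℂ e S) ≤ ⋁ (img 𝔸 ℂ e T) →
      Σ (List A.Carrier) λ xs → Σ (List A.Carrier) λ ys →
        All S xs × All T ys × (foldr A._∧_ A.⊤ xs A.≤ foldr A._∨_ A.⊥ ys)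
    ◇δ : Carrier → Carrier
    □δ : Carrier → Carrier
    ◇δ-σ : IsSigmaExt 𝔸 ℂ e ◇δ
    □δ-π : IsPiExt 𝔸 ℂ e □δ

  -- ◆ : the left adjoint of □δ,  ◆u = ⋀ { v | u ≤ □δ v }
  ◆ : Carrier → Carrier
  ◆ u = ⋀ {Σ Carrier (λ v → u ≤ □δ v)} proj₁

  -- ■ : the right adjoint of ◇δ, ■u = ⋁ { v | ◇δ v ≤ u }
  ■ : Carrier → Carrier
  ■ u = ⋁ {Σ Carrier (λ v → ◇δ v ≤ u)} proj₁

  ⊤δ ⊥δ : Carrier
  ⊤δ = ⋀ {Σ Carrier (λ _ → Empty' {ℓ})} proj₁
  ⊥δ = ⋁ {Σ Carrier (λ _ → Empty' {ℓ})} proj₁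

  _∧δ_ _∨δ_ : Carrier → Carrier → Carrier
  u ∧δ v = ⋀ {Σ Carrier (λ x → (x ≡ u) ⊎' (x ≡ v))} proj₁
  u ∨δ v = ⋁ {Σ Carrier (λ x → (x ≡ u) ⊎' (x ≡ v))} proj₁

data Term : Set where
  var   : ℕ → Term
  nom   : ℕ → Term
  conom : ℕ → Term
  ⊤ₜ ⊥ₜ : Term
  _∧ₜ_ _∨ₜ_ : Term → Term → Term
  ◇ₜ □ₜ ◆ₜ ■ₜ : Term → Term

record Ineq : Set where
  constructor _≤ₜ_
  field
    lhs rhs : Term

NomFreeT : ℕ → Term → Set
NomFreeT n (var _) = ⊤₀
NomFreeT n (nom i) = ¬ (i ≡ n)
NomFreeT n (conom _) = ⊤₀
NomFreeT n ⊤ₜ = ⊤₀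
NomFreeT n ⊥ₜ = ⊤₀
NomFreeT n (s ∧ₜ t) = NomFreeT n s × NomFreeT n t
NomFreeT n (s ∨ₜ t) = NomFreeT n s × NomFreeT n t
NomFreeT n (◇ₜ t) = NomFreeT n t
NomFreeT n (□ₜ t) = NomFreeT n t
NomFreeT n (◆ₜ t) = NomFreeT n t
NomFreeT n (■ₜ t) = NomFreeT n t

NomFree : ℕ → Ineq → Set
NomFree n (s ≤ₜ t) = NomFreeT n s × NomFreeT n t

module _ {ℓ : Level} {𝔸 : LAlgebra ℓ} (D : CanonicalExtension 𝔸) where
  open CanonicalExtension D

  CompletelyJoinGenerating : Pred Carrier ℓ → Set ℓ
  CompletelyJoinGenerating 𝕁 = ∀ u → u ≈ ⋁ {Σ Carrier (λ j → 𝕁 j × j ≤ u)} proj₁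

  CompletelyMeetGenerating : Pred Carrier ℓ → Set ℓ
  CompletelyMeetGenerating 𝕄 = ∀ u → u ≈ ⋀ {Σ Carrier (λ m → 𝕄 m × u ≤ m)} proj₁

  record Assignment (𝕁 𝕄 : Pred Carrier ℓ) : Set ℓ where
    field
      val   : ℕ → Carrier
      nomv  : ℕ → Σ Carrier 𝕁
      conv  : ℕ → Σ Carrier 𝕄

  module _ {𝕁 𝕄 : Pred Carrier ℓ} where
    ⟦_⟧ : Term → Assignment 𝕁 𝕄 → Carrier
    ⟦ var p ⟧ ρ = Assignment.val ρ p
    ⟦ nom j ⟧ ρ = proj₁ (Assignment.nomv ρ j)
    ⟦ conom m ⟧ ρ = proj₁ (Assignment.conv ρ m)
    ⟦ ⊤ₜ ⟧ ρ = ⊤δ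
    ⟦ ⊥ₜ ⟧ ρ = ⊥δ
    ⟦ s ∧ₜ t ⟧ ρ = ⟦ s ⟧ ρ ∧δ ⟦ t ⟧ ρ
    ⟦ s ∨ₜ t ⟧ ρ = ⟦ s ⟧ ρ ∨δ ⟦ t ⟧ ρ
    ⟦ ◇ₜ t ⟧ ρ = ◇δ (⟦ t ⟧ ρ)
    ⟦ □ₜ t ⟧ ρ = □δ (⟦ t ⟧ ρ)
    ⟦ ◆ₜ t ⟧ ρ = ◆ (⟦ t ⟧ ρ)
    ⟦ ■ₜ t ⟧ ρ = ■ (⟦ t ⟧ ρ)

    Sat : Assignment 𝕁 𝕄 → Ineq → Set ℓ
    Sat ρ (s ≤ₜ t) = ⟦ s ⟧ ρ ≤ ⟦ t ⟧ ρ

  Valid : (𝕁 𝕄 : Pred Carrier ℓ) → List Ineq → List Ineq → Set ℓ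
  Valid 𝕁 𝕄 Γ Δ = (ρ : Assignment 𝕁 𝕄) → All (Sat ρ) Γ → Any (Sat ρ) Δ

-- Fix ρ with h ≤ ◇j and Γ true; by excluded middle we may assume Δ fails.  Then the
-- premise, instantiated at every join-generator x ≤ ◆j, yields ◇x ≤ m, so ◇◆j ≤ m because
-- ◇δ preserves arbitrary joins.  The inequality ◇□u ≤ □◇u holds in 𝔸^δ, and with the
-- adjunction ◆ ⊣ □δ it turns ◇◆j ≤ m into ◆◇j ≤ m; hence ◆h ≤ ◆◇j ≤ m.
-- Complete join and meet preservation, and canonicity, come from density and compactness:
-- for open o and closed c, both ◇δ u ≤ o and c ≤ □δ u are equivalent to comparing u with a
-- join, resp. meet, of elements of 𝔸.
module Submission where

open import Defs
open import Level using (Level) renaming (suc to lsuc)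
open import Data.Nat using (ℕ; _≟_)
open import Data.List using (List; []; _∷_; foldr)
open import Data.List.Relation.Unary.All using (All; []; _∷_)
open import Data.List.Relation.Unary.Any using (Any; here; there)
open import Data.Product using (Σ; _×_; _,_; proj₁; proj₂)
open import Data.Sum using (inj₁; inj₂)
open import Data.Empty using (⊥-elim)
open import Function.Base using (_∘_; id)
open import Function.Bundles using (Equivalence; _⇔_; mk⇔)
open import Relation.Binary.Bundles using (Poset)
open import Relation.Binary.PropositionalEquality using (_≡_; refl; sym; cong; cong₂; subst; subst₂)
open import Relation.Nullary using (¬_; yes; no)
open import Relation.Unary using (Pred; _⊢_)
open import Axiom.ExcludedMiddle using (ExcludedMiddle)
import Relation.Binary.Lattice.Properties.JoinSemilattice as JoinSemilatticeProperties
import Relation.Binary.Reasoning.PartialOrder as ≤-Reasoning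

open Equivalence using (to; from)

module LAlgebraProperties {ℓ : Level} (𝔸 : LAlgebra ℓ) where
  open LAlgebra 𝔸 renaming (refl to ≤-refl)
  open ≤-Reasoning poset
  open JoinSemilatticeProperties joinSemilattice using (x≤y⇒x∨y≈y)

  ◇-mono : ∀ {a b} → a ≤ b → ◇ a ≤ ◇ b
  ◇-mono {a} {b} a≤b = begin
    ◇ a        ≤⟨ x≤x∨y (◇ a) (◇ b) ⟩
    ◇ a ∨ ◇ b  ≈⟨ Eq.sym (◇-∨ a b) ⟩
    ◇ (a ∨ b)  ≈⟨ ◇-cong (x≤y⇒x∨y≈y a≤b) ⟩
    ◇ b        ∎

  □-mono : ∀ {a b} → a ≤ b → □ a ≤ □ b
  □-mono {a} {b} a≤b = begin
    □ a        ≈⟨ □-cong (antisym (∧-greatest ≤-refl a≤b) (x∧y≤x a b)) ⟩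
    □ (a ∧ b)  ≈⟨ □-∧ a b ⟩
    □ a ∧ □ b  ≤⟨ x∧y≤y (□ a) (□ b) ⟩
    □ b        ∎

  record DownDirected (S : Pred Carrier ℓ) : Set ℓ where
    field
      inhabitant : Σ Carrier S
      lowerBound : ∀ {a b} → S a → S b → Σ Carrier λ c → S c × c ≤ a × c ≤ b

  record UpDirected (T : Pred Carrier ℓ) : Set ℓ where
    field
      inhabitant : Σ Carrier T
      upperBound : ∀ {a b} → T a → T b → Σ Carrier λ c → T c × a ≤ c × b ≤ c

  DownDirected-≤⋀ : ∀ {S} → DownDirected S → ∀ {xs} → All S xs →
                    Σ Carrier λ c → S c × c ≤ foldr _∧_ ⊤ xs
  DownDirected-≤⋀ S↓ [] = let c , c∈S = DownDirected.inhabitant S↓ in c , c∈S , maximum c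
  DownDirected-≤⋀ S↓ (x∈S ∷ xs⊆S) with DownDirected-≤⋀ S↓ xs⊆S
  ... | c , c∈S , c≤⋀xs with DownDirected.lowerBound S↓ x∈S c∈S
  ...   | d , d∈S , d≤x , d≤c = d , d∈S , ∧-greatest d≤x (trans d≤c c≤⋀xs)

  UpDirected-⋁≤ : ∀ {T} → UpDirected T → ∀ {ys} → All T ys →
                  Σ Carrier λ c → T c × foldr _∨_ ⊥ ys ≤ c
  UpDirected-⋁≤ T↑ [] = let c , c∈T = UpDirected.inhabitant T↑ in c , c∈T , minimum c
  UpDirected-⋁≤ T↑ (y∈T ∷ ys⊆T) with UpDirected-⋁≤ T↑ ys⊆T
  ... | c , c∈T , ⋁ys≤c with UpDirected.upperBound T↑ y∈T c∈T
  ...   | d , d∈T , y≤d , c≤d = d , d∈T , ∨-least y≤d (trans ⋁ys≤c c≤d)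

  Image : (Carrier → Carrier) → Pred Carrier ℓ → Pred Carrier ℓ
  Image f S d = Σ Carrier λ b → S b × d ≡ f b

  Image-downDirected : ∀ {f S} → (∀ {a b} → a ≤ b → f a ≤ f b) →
                       DownDirected S → DownDirected (Image f S)
  Image-downDirected {f} f-mono S↓ = record
    { inhabitant = let a , a∈S = DownDirected.inhabitant S↓ in f a , a , a∈S , refl
    ; lowerBound = λ { (a , a∈S , refl) (b , b∈S , refl) →
        let c , c∈S , c≤a , c≤b = DownDirected.lowerBound S↓ a∈S b∈S
        in f c , (c , c∈S , refl) , f-mono c≤a , f-mono c≤b }
    }

  Image-upDirected : ∀ {f T} → (∀ {a b} → a ≤ b → f a ≤ f b) →
                     UpDirected T → UpDirected (Image f T)
  Image-upDirected {f} f-mono T↑ = record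
    { inhabitant = let a , a∈T = UpDirected.inhabitant T↑ in f a , a , a∈T , refl
    ; upperBound = λ { (a , a∈T , refl) (b , b∈T , refl) →
        let c , c∈T , a≤c , b≤c = UpDirected.upperBound T↑ a∈T b∈T
        in f c , (c , c∈T , refl) , f-mono a≤c , f-mono b≤c }
    }

module CanonicalExtensionProperties {ℓ : Level} {𝔸 : LAlgebra ℓ} (D : CanonicalExtension 𝔸) where
  private
    module A = LAlgebra 𝔸
  open LAlgebraProperties 𝔸
  open CanonicalExtension D
  private
    module E = IsLatticeEmbedding embedding

  poset : Poset ℓ ℓ ℓ
  poset = record { isPartialOrder = isPartialOrder }

  open Poset poset public using ()
    renaming (refl to ≤-refl; reflexive to ≤-reflexive; trans to ≤-trans; antisym to ≤-antisym)
  open Poset.Eq poset public using () renaming (refl to ≈-refl; sym to ≈-sym)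
  open ≤-Reasoning poset

  IsClosed IsOpen : Carrier → Set (lsuc ℓ)
  IsClosed = Closed 𝔸 ℂ e
  IsOpen = Open 𝔸 ℂ e

  e[_] : (S : Pred A.Carrier ℓ) → Σ A.Carrier S → Carrier
  e[ S ] = img 𝔸 ℂ e S

  Above Below : Carrier → Pred A.Carrier ℓ
  Above u a = u ≤ e a
  Below u a = e a ≤ u

  e-mono : ∀ {a b} → a A.≤ b → e a ≤ e b
  e-mono = to (E.order-embedding _ _)

  e-reflect : ∀ {a b} → e a ≤ e b → a A.≤ b
  e-reflect = from (E.order-embedding _ _)

  ≤e-∧ : ∀ {u a b} → u ≤ e a → u ≤ e b → u ≤ e (a A.∧ b)
  ≤e-∧ {u} {a} {b} u≤ea u≤eb =
    ≤-trans (⋀-greatest _ u λ { (_ , inj₁ refl) → u≤ea ; (_ , inj₂ refl) → u≤eb })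
            (≤-reflexive (≈-sym (E.e-∧ a b)))

  ≤e-⊤ : ∀ {u} → u ≤ e A.⊤
  ≤e-⊤ {u} = ≤-trans (⋀-greatest _ u λ ()) (≤-reflexive (≈-sym E.e-⊤))

  e-∨≤ : ∀ {u a b} → e a ≤ u → e b ≤ u → e (a A.∨ b) ≤ u
  e-∨≤ {u} {a} {b} ea≤u eb≤u =
    ≤-trans (≤-reflexive (E.e-∨ a b)) (⋁-least _ u λ { (_ , inj₁ refl) → ea≤u ; (_ , inj₂ refl) → eb≤u })

  e-⊥≤ : ∀ {u} → e A.⊥ ≤ u
  e-⊥≤ {u} = ≤-trans (≤-reflexive E.e-⊥) (⋁-least _ u λ ())

  e-closed : ∀ a → IsClosed (e a)
  e-closed a = (_≡ a) , ≤-antisym (⋀-greatest _ _ λ { (_ , refl) → ≤-refl }) (⋀-lower _ (a , refl))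

  Above-downDirected : ∀ u → DownDirected (Above u)
  Above-downDirected u = record
    { inhabitant = A.⊤ , ≤e-⊤
    ; lowerBound = λ u≤ea u≤eb → _ , ≤e-∧ u≤ea u≤eb , A.x∧y≤x _ _ , A.x∧y≤y _ _
    }

  Below-upDirected : ∀ u → UpDirected (Below u)
  Below-upDirected u = record
    { inhabitant = A.⊥ , e-⊥≤
    ; upperBound = λ ea≤u eb≤u → _ , e-∨≤ ea≤u eb≤u , A.x≤x∨y _ _ , A.y≤x∨y _ _
    }

  ◇⊢Below-upDirected : ∀ u → UpDirected (A.◇ ⊢ Below u)
  ◇⊢Below-upDirected u = record
    { inhabitant = A.⊥ , ≤-trans (e-mono (A.reflexive A.◇-⊥)) e-⊥≤
    ; upperBound = λ {a} {b} e◇a≤u e◇b≤u →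
        a A.∨ b , ≤-trans (e-mono (A.reflexive (A.◇-∨ a b))) (e-∨≤ e◇a≤u e◇b≤u) ,
        A.x≤x∨y _ _ , A.y≤x∨y _ _
    }

  □⊢Above-downDirected : ∀ u → DownDirected (A.□ ⊢ Above u)
  □⊢Above-downDirected u = record
    { inhabitant = A.⊤ , ≤-trans ≤e-⊤ (e-mono (A.reflexive (A.Eq.sym A.□-⊤)))
    ; lowerBound = λ {a} {b} u≤e□a u≤e□b →
        a A.∧ b , ≤-trans (≤e-∧ u≤e□a u≤e□b) (e-mono (A.reflexive (A.Eq.sym (A.□-∧ a b)))) ,
        A.x∧y≤x _ _ , A.x∧y≤y _ _
    }

  compact-directed : ∀ {S T} → DownDirected S → UpDirected T → ⋀ e[ S ] ≤ ⋁ e[ T ] →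
                     Σ A.Carrier λ a → S a × Σ A.Carrier λ b → T b × a A.≤ b
  compact-directed {S} {T} S↓ T↑ ⋀S≤⋁T with compact S T ⋀S≤⋁T
  ... | xs , ys , xs⊆S , ys⊆T , ⋀xs≤⋁ys with DownDirected-≤⋀ S↓ xs⊆S | UpDirected-⋁≤ T↑ ys⊆T
  ...   | a , a∈S , a≤⋀xs | b , b∈T , ⋁ys≤b = a , a∈S , b , b∈T , A.trans a≤⋀xs (A.trans ⋀xs≤⋁ys ⋁ys≤b)

  ⋀Above≤closed : ∀ {k} → IsClosed k → ⋀ e[ Above k ] ≤ k
  ⋀Above≤closed {k} (S , k≈⋀S) = ≤-trans
    (⋀-greatest e[ S ] _ λ { (a , a∈S) →
      ⋀-lower e[ Above k ] (a , ≤-trans (≤-reflexive k≈⋀S) (⋀-lower e[ S ] (a , a∈S))) })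
    (≤-reflexive (≈-sym k≈⋀S))

  open≤⋁Below : ∀ {o} → IsOpen o → o ≤ ⋁ e[ Below o ]
  open≤⋁Below {o} (T , o≈⋁T) = ≤-trans (≤-reflexive o≈⋁T)
    (⋁-least e[ T ] _ λ { (a , a∈T) →
      ⋁-upper e[ Below o ] (a , ≤-trans (⋁-upper e[ T ] (a , a∈T)) (≤-reflexive (≈-sym o≈⋁T))) })

  closed≤⋁⇒≤e : ∀ {k T} → IsClosed k → UpDirected T → k ≤ ⋁ e[ T ] → Σ A.Carrier λ a → T a × k ≤ e a
  closed≤⋁⇒≤e {k} k-closed T↑ k≤⋁T
    with compact-directed (Above-downDirected k) T↑ (≤-trans (⋀Above≤closed k-closed) k≤⋁T)
  ... | a , k≤ea , b , b∈T , a≤b = b , b∈T , ≤-trans k≤ea (e-mono a≤b)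

  ⋀≤open⇒e≤ : ∀ {S o} → DownDirected S → IsOpen o → ⋀ e[ S ] ≤ o → Σ A.Carrier λ a → S a × e a ≤ o
  ⋀≤open⇒e≤ {S} {o} S↓ o-open ⋀S≤o
    with compact-directed S↓ (Below-upDirected o) (≤-trans ⋀S≤o (open≤⋁Below o-open))
  ... | a , a∈S , b , eb≤o , a≤b = a , a∈S , ≤-trans (e-mono a≤b) eb≤o

  ◇δ-closed≤ : ∀ {k a} → IsClosed k → k ≤ e a → ◇δ k ≤ e (A.◇ a)
  ◇δ-closed≤ k-closed k≤ea = ≤-trans (≤-reflexive (proj₁ ◇δ-σ _ k-closed)) (⋀-lower _ (_ , k≤ea))

  ◇δ-≤ : ∀ {u v} → (∀ k → IsClosed k → k ≤ u → ◇δ k ≤ v) → ◇δ u ≤ v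
  ◇δ-≤ {u} {v} = proj₂ (proj₂ ◇δ-σ u) v

  ◇δ-mono : ∀ {u v} → u ≤ v → ◇δ u ≤ ◇δ v
  ◇δ-mono {u} {v} u≤v = ◇δ-≤ λ k k-closed k≤u → proj₁ (proj₂ ◇δ-σ v) k k-closed (≤-trans k≤u u≤v)

  □δ-open≥ : ∀ {o a} → IsOpen o → e a ≤ o → e (A.□ a) ≤ □δ o
  □δ-open≥ o-open ea≤o = ≤-trans (⋁-upper _ (_ , ea≤o)) (≤-reflexive (≈-sym (proj₁ □δ-π _ o-open)))

  ≤-□δ : ∀ {u v} → (∀ o → IsOpen o → u ≤ o → v ≤ □δ o) → v ≤ □δ u
  ≤-□δ {u} {v} = proj₂ (proj₂ □δ-π u) v

  □δ-mono : ∀ {u v} → u ≤ v → □δ u ≤ □δ v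
  □δ-mono {u} {v} u≤v = ≤-□δ λ o o-open v≤o → proj₁ (proj₂ □δ-π u) o o-open (≤-trans u≤v v≤o)

  ◇δ-closed≤open : ∀ {k o} → IsClosed k → IsOpen o → ◇δ k ≤ o → Σ A.Carrier λ b → k ≤ e b × e (A.◇ b) ≤ o
  ◇δ-closed≤open {k} {o} k-closed o-open ◇k≤o
    with ⋀≤open⇒e≤ (Image-downDirected ◇-mono (Above-downDirected k)) o-open (≤-trans ⋀◇Above≤◇k ◇k≤o)
    where
    ⋀◇Above≤◇k : ⋀ e[ Image A.◇ (Above k) ] ≤ ◇δ k
    ⋀◇Above≤◇k = ≤-trans
      (⋀-greatest _ _ λ { (a , k≤ea) → ⋀-lower e[ Image A.◇ (Above k) ] (A.◇ a , a , k≤ea , refl) })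
      (≤-reflexive (≈-sym (proj₁ ◇δ-σ k k-closed)))
  ... | _ , (b , k≤eb , refl) , e◇b≤o = b , k≤eb , e◇b≤o

  closed≤□δ-open : ∀ {c o} → IsClosed c → IsOpen o → c ≤ □δ o → Σ A.Carrier λ b → e b ≤ o × c ≤ e (A.□ b)
  closed≤□δ-open {c} {o} c-closed o-open c≤□o
    with closed≤⋁⇒≤e c-closed (Image-upDirected □-mono (Below-upDirected o)) (≤-trans c≤□o □o≤⋁□Below)
    where
    □o≤⋁□Below : □δ o ≤ ⋁ e[ Image A.□ (Below o) ]
    □o≤⋁□Below = ≤-trans (≤-reflexive (proj₁ □δ-π o o-open))
      (⋁-least _ _ λ { (a , ea≤o) → ⋁-upper e[ Image A.□ (Below o) ] (A.□ a , a , ea≤o , refl) })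
  ... | _ , (b , eb≤o , refl) , c≤e□b = b , eb≤o , c≤e□b

  ◇-residual : Carrier → Carrier
  ◇-residual o = ⋁ e[ A.◇ ⊢ Below o ]

  ◇-residual-open : ∀ o → IsOpen (◇-residual o)
  ◇-residual-open o = A.◇ ⊢ Below o , ≈-refl

  ◇δ≤⇔≤◇-residual : ∀ {u o} → IsOpen o → (◇δ u ≤ o) ⇔ (u ≤ ◇-residual o)
  ◇δ≤⇔≤◇-residual {u} {o} o-open = mk⇔
    (λ ◇u≤o → dense-closed u _ λ k k-closed k≤u →
      let b , k≤eb , e◇b≤o = ◇δ-closed≤open k-closed o-open (≤-trans (◇δ-mono k≤u) ◇u≤o)
      in ≤-trans k≤eb (⋁-upper e[ A.◇ ⊢ Below o ] (b , e◇b≤o)))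
    (λ u≤res → ◇δ-≤ λ k k-closed k≤u →
      let a , e◇a≤o , k≤ea = closed≤⋁⇒≤e k-closed (◇⊢Below-upDirected o) (≤-trans k≤u u≤res)
      in ≤-trans (◇δ-closed≤ k-closed k≤ea) e◇a≤o)

  □-residual : Carrier → Carrier
  □-residual c = ⋀ e[ A.□ ⊢ Above c ]

  ≤□δ⇔□-residual≤ : ∀ {c u} → IsClosed c → (c ≤ □δ u) ⇔ (□-residual c ≤ u)
  ≤□δ⇔□-residual≤ {c} {u} c-closed = mk⇔
    (λ c≤□u → dense-open u _ λ o o-open u≤o →
      let b , eb≤o , c≤e□b = closed≤□δ-open c-closed o-open (≤-trans c≤□u (□δ-mono u≤o))
      in ≤-trans (⋀-lower e[ A.□ ⊢ Above c ] (b , c≤e□b)) eb≤o)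
    (λ res≤u → ≤-□δ λ o o-open u≤o →
      let a , c≤e□a , ea≤o = ⋀≤open⇒e≤ (□⊢Above-downDirected c) o-open (≤-trans res≤u u≤o)
      in ≤-trans c≤e□a (□δ-open≥ o-open ea≤o))

  ◇δ-⋁ : ∀ {I : Set ℓ} (f : I → Carrier) v → (∀ i → ◇δ (f i) ≤ v) → ◇δ (⋁ f) ≤ v
  ◇δ-⋁ f v ◇f≤v = dense-open v _ λ o o-open v≤o →
    from (◇δ≤⇔≤◇-residual o-open)
      (⋁-least f _ λ i → to (◇δ≤⇔≤◇-residual o-open) (≤-trans (◇f≤v i) v≤o))

  □δ-⋀ : ∀ {I : Set ℓ} (f : I → Carrier) u → (∀ i → u ≤ □δ (f i)) → u ≤ □δ (⋀ f)
  □δ-⋀ f u u≤□f = dense-closed u _ λ c c-closed c≤u →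
    from (≤□δ⇔□-residual≤ c-closed)
      (⋀-greatest f _ λ i → to (≤□δ⇔□-residual≤ c-closed) (≤-trans c≤u (u≤□f i)))

  ◇δ□δ≤□δ◇δ : ModelsC 𝔸 → ∀ u → ◇δ (□δ u) ≤ □δ (◇δ u)
  ◇δ□δ≤□δ◇δ ◇□≤□◇ u = ◇δ-≤ λ k k-closed k≤□u → ≤-□δ λ o o-open ◇u≤o →
    ◇closed≤□open k-closed o-open k≤□u ◇u≤o
    where
    -- Compactness yields b ≤ c in 𝔸 with e (◇ c) ≤ o, so the axiom can be applied to c in 𝔸.
    ◇closed≤□open : ∀ {k o} → IsClosed k → IsOpen o → k ≤ □δ u → ◇δ u ≤ o → ◇δ k ≤ □δ o
    ◇closed≤□open {k} {o} k-closed o-open k≤□u ◇u≤o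
      with closed≤□δ-open k-closed (◇-residual-open o)
             (≤-trans k≤□u (□δ-mono (to (◇δ≤⇔≤◇-residual o-open) ◇u≤o)))
    ... | b , eb≤res , k≤e□b with closed≤⋁⇒≤e (e-closed b) (◇⊢Below-upDirected o) eb≤res
    ...   | c , e◇c≤o , eb≤ec = begin
      ◇δ k             ≤⟨ ◇δ-closed≤ k-closed k≤e□b ⟩
      e (A.◇ (A.□ b))  ≤⟨ e-mono (◇-mono (□-mono (e-reflect eb≤ec))) ⟩
      e (A.◇ (A.□ c))  ≤⟨ e-mono (◇□≤□◇ c) ⟩
      e (A.□ (A.◇ c))  ≤⟨ □δ-open≥ o-open e◇c≤o ⟩
      □δ o             ∎

  ◆-mono : ∀ {u v} → u ≤ v → ◆ u ≤ ◆ v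
  ◆-mono u≤v = ⋀-greatest _ _ λ { (w , v≤□w) → ⋀-lower _ (w , ≤-trans u≤v v≤□w) }

  ◆-adjoint : ∀ {u v} → u ≤ □δ v → ◆ u ≤ v
  ◆-adjoint u≤□v = ⋀-lower _ (_ , u≤□v)

  ◆-unit : ∀ u → u ≤ □δ (◆ u)
  ◆-unit u = □δ-⋀ proj₁ u proj₂

  ◇δ◆≤⇒◆◇δ≤ : ModelsC 𝔸 → ∀ {u v} → ◇δ (◆ u) ≤ v → ◆ (◇δ u) ≤ v
  ◇δ◆≤⇒◆◇δ≤ ◇□≤□◇ {u} {v} ◇◆u≤v = ◆-adjoint (begin
    ◇δ u              ≤⟨ ◇δ-mono (◆-unit u) ⟩
    ◇δ (□δ (◆ u))     ≤⟨ ◇δ□δ≤□δ◇δ ◇□≤□◇ (◆ u) ⟩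
    □δ (◇δ (◆ u))     ≤⟨ □δ-mono ◇◆u≤v ⟩
    □δ v              ∎)

  ◇δ-≤-joinGenerators : ∀ {𝕁} → CompletelyJoinGenerating D 𝕁 → ∀ {u v} →
                        (∀ j → 𝕁 j → j ≤ u → ◇δ j ≤ v) → ◇δ u ≤ v
  ◇δ-≤-joinGenerators 𝕁-generating {u} {v} ◇j≤v =
    ≤-trans (◇δ-mono (≤-reflexive (𝕁-generating u))) (◇δ-⋁ proj₁ v λ { (j , j∈𝕁 , j≤u) → ◇j≤v j j∈𝕁 j≤u })

_[_≔_] : ∀ {a} {X : Set a} → (ℕ → X) → ℕ → X → ℕ → X
(g [ k ≔ x ]) n with n ≟ k
... | yes _ = x
... | no _ = g n

[≔]-same : ∀ {a} {X : Set a} (g : ℕ → X) k x → (g [ k ≔ x ]) k ≡ x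
[≔]-same g k x with k ≟ k
... | yes _ = refl
... | no k≢k = ⊥-elim (k≢k refl)

[≔]-other : ∀ {a} {X : Set a} (g : ℕ → X) {k} x {n} → ¬ n ≡ k → (g [ k ≔ x ]) n ≡ g n
[≔]-other g {k} x {n} n≢k with n ≟ k
... | yes n≡k = ⊥-elim (n≢k n≡k)
... | no _ = refl

module Assignments {ℓ : Level} {𝔸 : LAlgebra ℓ} (D : CanonicalExtension 𝔸)
                   {𝕁 𝕄 : Pred (CanonicalExtension.Carrier D) ℓ} where
  open CanonicalExtension D

  _⟨_≔_⟩ : Assignment D 𝕁 𝕄 → ℕ → Σ Carrier 𝕁 → Assignment D 𝕁 𝕄
  ρ ⟨ k ≔ x ⟩ = record ρ { nomv = Assignment.nomv ρ [ k ≔ x ] }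

  ⟦nom⟧-⟨≔⟩-same : ∀ ρ k x → ⟦_⟧ D (nom k) (ρ ⟨ k ≔ x ⟩) ≡ proj₁ x
  ⟦nom⟧-⟨≔⟩-same ρ k x = cong proj₁ ([≔]-same (Assignment.nomv ρ) k x)

  ⟦⟧-⟨≔⟩-fresh : ∀ ρ {k} x t → NomFreeT k t → ⟦_⟧ D t (ρ ⟨ k ≔ x ⟩) ≡ ⟦_⟧ D t ρ
  ⟦⟧-⟨≔⟩-fresh ρ x (var _) _ = refl
  ⟦⟧-⟨≔⟩-fresh ρ x (nom i) i≢k = cong proj₁ ([≔]-other (Assignment.nomv ρ) x i≢k)
  ⟦⟧-⟨≔⟩-fresh ρ x (conom _) _ = refl
  ⟦⟧-⟨≔⟩-fresh ρ x ⊤ₜ _ = refl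
  ⟦⟧-⟨≔⟩-fresh ρ x ⊥ₜ _ = refl
  ⟦⟧-⟨≔⟩-fresh ρ x (s ∧ₜ t) (s-fresh , t-fresh) =
    cong₂ _∧δ_ (⟦⟧-⟨≔⟩-fresh ρ x s s-fresh) (⟦⟧-⟨≔⟩-fresh ρ x t t-fresh)
  ⟦⟧-⟨≔⟩-fresh ρ x (s ∨ₜ t) (s-fresh , t-fresh) =
    cong₂ _∨δ_ (⟦⟧-⟨≔⟩-fresh ρ x s s-fresh) (⟦⟧-⟨≔⟩-fresh ρ x t t-fresh)
  ⟦⟧-⟨≔⟩-fresh ρ x (◇ₜ t) t-fresh = cong ◇δ (⟦⟧-⟨≔⟩-fresh ρ x t t-fresh)
  ⟦⟧-⟨≔⟩-fresh ρ x (□ₜ t) t-fresh = cong □δ (⟦⟧-⟨≔⟩-fresh ρ x t t-fresh)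
  ⟦⟧-⟨≔⟩-fresh ρ x (◆ₜ t) t-fresh = cong ◆ (⟦⟧-⟨≔⟩-fresh ρ x t t-fresh)
  ⟦⟧-⟨≔⟩-fresh ρ x (■ₜ t) t-fresh = cong ■ (⟦⟧-⟨≔⟩-fresh ρ x t t-fresh)

  Sat-⟨≔⟩-fresh : ∀ ρ {k} x i → NomFree k i → Sat D (ρ ⟨ k ≔ x ⟩) i ≡ Sat D ρ i
  Sat-⟨≔⟩-fresh ρ x (s ≤ₜ t) (s-fresh , t-fresh) =
    cong₂ _≤_ (⟦⟧-⟨≔⟩-fresh ρ x s s-fresh) (⟦⟧-⟨≔⟩-fresh ρ x t t-fresh)

  All-⟨≔⟩-fresh : ∀ ρ {k} x {Γ} → All (NomFree k) Γ → All (Sat D ρ) Γ → All (Sat D (ρ ⟨ k ≔ x ⟩)) Γ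
  All-⟨≔⟩-fresh ρ x [] [] = []
  All-⟨≔⟩-fresh ρ x {i ∷ _} (i-fresh ∷ Γ-fresh) (⊨i ∷ ⊨Γ) =
    subst id (sym (Sat-⟨≔⟩-fresh ρ x i i-fresh)) ⊨i ∷ All-⟨≔⟩-fresh ρ x Γ-fresh ⊨Γ

  Any-⟨≔⟩-fresh : ∀ ρ {k} x {Δ} → All (NomFree k) Δ → Any (Sat D (ρ ⟨ k ≔ x ⟩)) Δ → Any (Sat D ρ) Δ
  Any-⟨≔⟩-fresh ρ x {i ∷ _} (i-fresh ∷ _) (here ⊨i) = here (subst id (Sat-⟨≔⟩-fresh ρ x i i-fresh) ⊨i)
  Any-⟨≔⟩-fresh ρ x (_ ∷ Δ-fresh) (there ⊨Δ) = there (Any-⟨≔⟩-fresh ρ x Δ-fresh ⊨Δ)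

mainTheorem4 : {ℓ : Level} → ExcludedMiddle ℓ →
    (𝔸 : LAlgebra ℓ) → ModelsC 𝔸 →
    (D : CanonicalExtension 𝔸) →
    (𝕁 𝕄 : Pred (CanonicalExtension.Carrier D) ℓ) →
    CompletelyJoinGenerating D 𝕁 → CompletelyMeetGenerating D 𝕄 →
    (Γ Δ : List Ineq) (j k h m : ℕ) →
    All (NomFree k) Γ → All (NomFree k) Δ → ¬ (k ≡ j) → ¬ (k ≡ h) →
    Valid D 𝕁 𝕄 ((nom k ≤ₜ ◆ₜ (nom j)) ∷ Γ) ((◇ₜ (nom k) ≤ₜ conom m) ∷ Δ) →
    Valid D 𝕁 𝕄 ((nom h ≤ₜ ◇ₜ (nom j)) ∷ Γ) ((◆ₜ (nom h) ≤ₜ conom m) ∷ Δ)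
mainTheorem4 em 𝔸 ◇□≤□◇ D 𝕁 𝕄 𝕁-generating _ Γ Δ j k h m Γ-fresh Δ-fresh k≢j _ premise ρ (h≤◇j ∷ ⊨Γ)
  with em {Any (Sat D ρ) Δ}
... | yes ⊨Δ = there ⊨Δ
... | no ⊭Δ = here (≤-trans (◆-mono h≤◇j) (◇δ◆≤⇒◆◇δ≤ ◇□≤□◇ (◇δ-≤-joinGenerators 𝕁-generating ◇x≤m)))
  where
  open CanonicalExtension D
  open CanonicalExtensionProperties D
  open Assignments D

  ◇x≤m : ∀ x → 𝕁 x → x ≤ ◆ (⟦_⟧ D (nom j) ρ) → ◇δ x ≤ ⟦_⟧ D (conom m) ρ
  ◇x≤m x x∈𝕁 x≤◆j with premise (ρ ⟨ k ≔ (x , x∈𝕁) ⟩) (⊨k≤◆j ∷ All-⟨≔⟩-fresh ρ (x , x∈𝕁) Γ-fresh ⊨Γ)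
    where
    ⊨k≤◆j : Sat D (ρ ⟨ k ≔ (x , x∈𝕁) ⟩) (nom k ≤ₜ ◆ₜ (nom j))
    ⊨k≤◆j = subst₂ (λ a b → a ≤ ◆ b)
      (sym (⟦nom⟧-⟨≔⟩-same ρ k (x , x∈𝕁)))
      (sym (⟦⟧-⟨≔⟩-fresh ρ (x , x∈𝕁) (nom j) (k≢j ∘ sym))) x≤◆j
  ... | here ⊨◇k≤m = subst (λ a → ◇δ a ≤ _) (⟦nom⟧-⟨≔⟩-same ρ k (x , x∈𝕁)) ⊨◇k≤m
  ... | there ⊨Δ = ⊥-elim (⊭Δ (Any-⟨≔⟩-fresh ρ (x , x∈𝕁) Δ-fresh ⊨Δ))
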